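{- Let $(G,<)$ be a Latin instance with $G=(A\cup B,E)$, and let $(G',<')$ be the auxiliary instance constructed from it as described below. Then $\mathcal{L}(G',<')=\{M\cup\{\tilde a\tilde b\}: M\in\mathcal{S}(G,<)\}$.
   Context: A stable marriage instance $(G,<)$: $G=(A\cup B,E)$ finite simple bipartite graph (men $A$, women $B$), $<_v$ a strict total order on the neighbours of $v$. A matching has each vertex in at most one edge; $M(x)$ is the partner or $\emptyset$ (ranked below all neighbours). Edge $ab$ blocks $M$ if $b>_a M(a)$ and $a>_b M(b)$; a matching blocks $M$ if one of its edges does; $M$ is stable if no edge blocks it; $\mathcal{S}(G,<)$ is the set of stable matchings. A set $\mathcal{L}$ of matchings has the legal property if the matchings blocked by some member of $\mathcal{L}$ are exactly those not in $\mathcal{L}$; there is exactly one such set, denoted $\mathcal{L}(G,<)$. For complete lists ($G$ complete bipartite, $|A|=|B|=n$), the rank of $a$ in $b$'s list is its position (1 = most preferred). $(G,<)$ is Latin if there is an $n\times n$ Latin square $Q$, rows indexed by $A$, columns by $B$, with $Q(a,b)$ the rank of $b$ in $a$'s list and $n+1-Q(a,b)$ the rank of $a$ in $b$'s list. Auxiliary instance $(G',<')$: $A'=A\cup\{\tilde a\}$, $B'=B\cup\{\tilde b\}$, $G'$ complete bipartite on $A'\cup B'$, and (i) every $a\in A$ ranks $\tilde b$ last and ranks $B$ as in $<_a$; (ii) $\tilde a$ has an arbitrary ranking of $B'$ with $\tilde b$ last; (iii) every $b\in B$ ranks $\tilde a$ in the second position and ranks $A$ as in $<_b$; (iv) $\tilde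 b$ has an arbitrary ranking of $A'$ with $\tilde a$ first. -}

module Defs where

open import Data.Nat using (ℕ; zero; suc; _<_)
open import Data.Fin using (Fin; toℕ; fromℕ; opposite) renaming (zero to fz; suc to fs)
open import Data.Vec using (Vec; _∷_; lookup; map)
open import Data.Maybe using (Maybe; just; nothing) renaming (map to mmap)
open import Data.Bool using (Bool; true)
open import Data.Product using (Σ; _×_; ∃)
open import Data.Unit using (⊤)
open import Data.Empty using (⊥)
open import Relation.Nullary using (¬_)
open import Relation.Binary.PropositionalEquality using (_≡_)
open import Function.Definitions using (Injective)
open import Function.Bundles using (_⇔_)

-- Stable marriage instances with COMPLETE preference lists on
-- men A = Fin m and women B = Fin m (G complete bipartite).
-- Ranks are 0-based: rank 0 = most preferred.

record Instance (m : ℕ) : Set where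
  field
    rankA : Fin m → Fin m → Fin m   -- rankA a b = rank of b in a's list
    rankB : Fin m → Fin m → Fin m   -- rankB b a = rank of a in b's list
    injA  : ∀ a → Injective _≡_ _≡_ (rankA a)
    injB  : ∀ b → Injective _≡_ _≡_ (rankB b)
open Instance public

_∶_≻A_,_ : ∀ {m} → Instance m → Fin m → Fin m → Fin m → Set
I ∶ a ≻A b , b' = toℕ (rankA I a b) < toℕ (rankA I a b')

_∶_≻B_,_ : ∀ {m} → Instance m → Fin m → Fin m → Fin m → Set
I ∶ b ≻B a , a' = toℕ (rankB I b a) < toℕ (rankB I b a')

RawMatching : ℕ → Set
RawMatching m = Vec (Maybe (Fin m)) m

IsMatching : ∀ {m} → RawMatching m → Set
IsMatching {m} M = ∀ (a a' b : Fin m) → lookup M a ≡ just b → lookup M a' ≡ just b → a ≡ a'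

-- b >_a M(a), with ∅ ranked below every neighbour
PrefersToPartnerA : ∀ {m} → Instance m → RawMatching m → Fin m → Fin m → Set
PrefersToPartnerA I M a b with lookup M a
... | nothing = ⊤
... | just b' = I ∶ a ≻A b , b'

-- a >_b M(b), with ∅ ranked below every neighbour
PrefersToPartnerB : ∀ {m} → Instance m → RawMatching m → Fin m → Fin m → Set
PrefersToPartnerB I M b a = ∀ a' → lookup M a' ≡ just b → I ∶ b ≻B a , a'

BlockingEdge : ∀ {m} → Instance m → RawMatching m → Fin m → Fin m → Set
BlockingEdge I M a b = PrefersToPartnerA I M a b × PrefersToPartnerB I M b a

Blocks : ∀ {m} → Instance m → RawMatching m → RawMatching m → Set
Blocks I N M = Σ (Fin _) λ a → Σ (Fin _) λ b → lookup N a ≡ just b × BlockingEdge I M a b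

Stable : ∀ {m} → Instance m → RawMatching m → Set
Stable I M = IsMatching M × (∀ a b → ¬ BlockingEdge I M a b)

-- Sets of matchings (over a finite universe) as Boolean predicates on
-- raw matchings.

MatchingSet : ℕ → Set
MatchingSet m = RawMatching m → Bool

Legal : ∀ {m} → Instance m → MatchingSet m → Set
Legal I 𝓛 =
  (∀ M → 𝓛 M ≡ true → IsMatching M) ×
  (∀ M → IsMatching M →
     (Σ (RawMatching _) λ N → (𝓛 N ≡ true) × Blocks I N M) ⇔ (¬ (𝓛 M ≡ true)))

_≐_ : ∀ {m} → MatchingSet m → (RawMatching m → Set) → Set
𝓛 ≐ X = ∀ M → (𝓛 M ≡ true) ⇔ X M

-- Latin instances: Q a b = rank of b in a's list, and the rank of a in
-- b's list is n+1-Q(a,b) (1-based), i.e. opposite (Q a b) (0-based).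

IsLatinSquare : ∀ {n} → (Fin n → Fin n → Fin n) → Set
IsLatinSquare {n} Q = (∀ a → Injective _≡_ _≡_ (Q a)) × (∀ b → Injective _≡_ _≡_ (λ a → Q a b))

IsLatinInstance : ∀ {n} → Instance n → Set
IsLatinInstance {n} I = Σ (Fin n → Fin n → Fin n) λ Q →
  IsLatinSquare Q ×
  (∀ a b → rankA I a b ≡ Q a b) × (∀ a b → rankB I b a ≡ opposite (Q a b))

-- Auxiliary instance on Fin (suc n): index fz is the new man ã resp. the
-- new woman b̃; fs a is the original man a, fs b the original woman b.

IsAuxiliary : ∀ {n} → Instance n → Instance (suc n) → Set
IsAuxiliary {n} I I' =
  (∀ a → rankA I' (fs a) fz ≡ fromℕ n) ×
  (∀ a b b' → (I' ∶ fs a ≻A fs b , fs b') ⇔ (I ∶ a ≻A b , b')) ×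
  (rankA I' fz fz ≡ fromℕ n) ×
  (∀ b → toℕ (rankB I' (fs b) fz) ≡ 1) ×
  (∀ b a a' → (I' ∶ fs b ≻B fs a , fs a') ⇔ (I ∶ b ≻B a , a')) ×
  (toℕ (rankB I' fz fz) ≡ 0)

extend : ∀ {n} → RawMatching n → RawMatching (suc n)
extend M = just fz ∷ map (mmap fs) M

ExtendedStable : ∀ {n} → Instance n → RawMatching (suc n) → Set
ExtendedStable I M' = Σ (RawMatching _) λ M → Stable I M × M' ≡ extend M

-- Let W match ã with b̃ and every man a with the woman whose favourite he is. In a Latin
-- instance every man is the favourite of the woman he ranks last, so in W every woman of G',
-- b̃ included, holds her favourite and nothing blocks W; hence W belongs to every legal set.
-- W blocks every matching N without ãb̃: if ã is single, ãb̃ blocks; if ã holds a woman of B,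
-- some man a of A has no partner in B, and a blocks with the woman whose favourite he is
-- (a ranks b̃ last, and she ranks ã second). So all members contain ãb̃, and among such
-- matchings only edges of G can block. A matching containing ãb̃ that some edge ab of G
-- blocks is blocked by the extension of a stable matching of G containing ab, and in a
-- Latin instance one exists: pair every man with the woman of his rank Q(a,b).

module Submission where

open import Defs
open import Data.Nat using (ℕ; suc; _<_; _≤_; z≤n; s≤s; _<?_)
open import Data.Nat.Properties
  using (n≮0; n≢0⇒n>0; <-irrefl; <-asym; n<1+n; ≰⇒>; <⇒≱; ∸-monoʳ-≤; ≤-<-trans)
open import Data.Fin using (Fin; toℕ; fromℕ; fromℕ<; opposite; punchOut) renaming (zero to fz; suc to fs)
open import Data.Fin.Properties
  using (_≟_; any?; all?; ¬∀⟶∃¬; toℕ-injective; suc-injective; punchOut-injective; <⇒notInjective;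
         opposite-prop; opposite-involutive; toℕ-fromℕ<; toℕ<n; ≤fromℕ; ≤∧≢⇒<; 0≢1+n)
open import Data.Vec using (Vec; []; _∷_; lookup; map; tabulate)
open import Data.Vec.Properties using (lookup-map; lookup∘tabulate)
open import Data.Maybe using (Maybe; just; nothing) renaming (map to mmap)
open import Data.Maybe.Properties using (just-injective) renaming (≡-dec to ≡-decₘ)
open import Data.Bool using (true)
open import Data.Bool.Properties using () renaming (_≟_ to _≟ᵇ_)
open import Data.Product using (Σ; _×_; _,_; proj₁; proj₂)
open import Data.Product.Function.NonDependent.Propositional using (_×-⇔_)
open import Data.Unit using (tt)
open import Data.Empty using (⊥-elim)
open import Function using (_∘_; const)
open import Function.Definitions using (Injective; StrictlySurjective)
open import Function.Bundles using (_⇔_; mk⇔; Equivalence)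
import Function.Properties.Equivalence as ⇔
open import Relation.Nullary using (¬_; Dec; yes; no; does; contradiction)
open import Relation.Nullary.Decidable using (_×-dec_; _→-dec_; ¬?; decidable-stable; dec-true)
open import Relation.Binary.PropositionalEquality
  using (_≡_; _≢_; refl; sym; trans; cong; cong₂; subst; subst₂; module ≡-Reasoning)

open Equivalence using (to; from)

injective⇒strictlySurjective : ∀ {n} {f : Fin n → Fin n} →
  Injective _≡_ _≡_ f → StrictlySurjective _≡_ f
injective⇒strictlySurjective {suc n} {f} f-injective y with any? (λ x → f x ≟ y)
... | yes hit = hit
... | no miss = ⊥-elim (<⇒notInjective {f = punchOut∘f} (n<1+n n) punchOut∘f-injective)
  where
  y≢f : ∀ x → y ≢ f x
  y≢f x y≡fx = miss (x , sym y≡fx)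
  punchOut∘f : Fin (suc n) → Fin n
  punchOut∘f x = punchOut (y≢f x)
  punchOut∘f-injective : Injective _≡_ _≡_ punchOut∘f
  punchOut∘f-injective {x} {x'} eq = f-injective (punchOut-injective (y≢f x) (y≢f x') eq)

injective-zero-least : ∀ {n} {f : Fin n → Fin n} → Injective _≡_ _≡_ f →
  ∀ {x y} → toℕ (f x) ≡ 0 → y ≢ x → toℕ (f x) < toℕ (f y)
injective-zero-least f-injective fx≡0 y≢x rewrite fx≡0 =
  n≢0⇒n>0 λ fy≡0 → y≢x (f-injective (toℕ-injective (trans fy≡0 (sym fx≡0))))

opposite-reflects-< : ∀ {n} {i j : Fin n} → toℕ (opposite i) < toℕ (opposite j) → toℕ j < toℕ i
opposite-reflects-< {n} {i} {j} lt = ≰⇒> λ i≤j →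
  <⇒≱ lt (subst₂ _≤_ (sym (opposite-prop j)) (sym (opposite-prop i)) (∸-monoʳ-≤ n (s≤s i≤j)))

¬∀¬⇒∃₂ : ∀ {m} {P : Fin m → Fin m → Set} → (∀ a b → Dec (P a b)) →
  ¬ (∀ a b → ¬ P a b) → Σ (Fin m) λ a → Σ (Fin m) (P a)
¬∀¬⇒∃₂ {m} P? ¬∀¬P
  with a , ¬∀¬Pa ← ¬∀⟶∃¬ m _ (λ a → all? λ b → ¬? (P? a b)) ¬∀¬P
  with b , ¬¬Pab ← ¬∀⟶∃¬ m _ (λ b → ¬? (P? a b)) ¬∀¬Pa
  = a , b , decidable-stable (P? a b) ¬¬Pab

does≡true⇔ : ∀ {P : Set} (P? : Dec P) → (does P? ≡ true) ⇔ P
does≡true⇔ (yes p) = mk⇔ (const p) (const refl)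
does≡true⇔ (no ¬p) = mk⇔ (λ ()) (dec-true (no ¬p))

_≟ₘ_ : ∀ {m} (x y : Maybe (Fin m)) → Dec (x ≡ y)
_≟ₘ_ = ≡-decₘ _≟_

Favourite : ∀ {m} → Instance m → Fin m → Fin m → Set
Favourite J b a = toℕ (rankB J b a) ≡ 0

module _ {m} (J : Instance m) where

  favourite-preferred : ∀ {b a a'} → Favourite J b a → a' ≢ a → J ∶ b ≻B a , a'
  favourite-preferred {b} = injective-zero-least (injB J b)

  favourite-unbeaten : ∀ {b a a'} → Favourite J b a → ¬ (J ∶ b ≻B a' , a)
  favourite-unbeaten fav lt = n≮0 (subst (_ <_) fav lt)

  favourite-unique : ∀ {b a a'} → Favourite J b a → Favourite J b a' → a ≡ a'
  favourite-unique {b} fav fav' = injB J b (toℕ-injective (trans fav (sym fav')))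

  prefersA-matched : ∀ M {a b b'} → lookup M a ≡ just b' → PrefersToPartnerA J M a b ⇔ (J ∶ a ≻A b , b')
  prefersA-matched M {a} Ma≡b' with lookup M a
  prefersA-matched M refl | just _ = ⇔.refl

  prefersA-unmatched : ∀ M {a b} → lookup M a ≡ nothing → PrefersToPartnerA J M a b
  prefersA-unmatched M {a} Ma≡∅ with lookup M a
  prefersA-unmatched M refl | nothing = tt

  prefersA? : ∀ M a b → Dec (PrefersToPartnerA J M a b)
  prefersA? M a b with lookup M a
  ... | nothing = yes tt
  ... | just b' = toℕ (rankA J a b) <? toℕ (rankA J a b')

  prefersB? : ∀ M b a → Dec (PrefersToPartnerB J M b a)
  prefersB? M b a = all? λ a' → (lookup M a' ≟ₘ just b) →-dec (toℕ (rankB J b a) <? toℕ (rankB J b a'))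

  blockingEdge? : ∀ M a b → Dec (BlockingEdge J M a b)
  blockingEdge? M a b = prefersA? M a b ×-dec prefersB? M b a

  isMatching? : ∀ (M : RawMatching m) → Dec (IsMatching M)
  isMatching? M = all? λ a → all? λ a' → all? λ b →
    (lookup M a ≟ₘ just b) →-dec ((lookup M a' ≟ₘ just b) →-dec (a ≟ a'))

  favourites-isMatching : ∀ M → (∀ a b → lookup M a ≡ just b → Favourite J b a) → IsMatching M
  favourites-isMatching M favourites a a' b Ma≡b Ma'≡b =
    favourite-unique (favourites a b Ma≡b) (favourites a' b Ma'≡b)

  favourites-unblocked : ∀ M → (∀ a b → lookup M a ≡ just b → Favourite J b a) →
    (∀ b → Σ (Fin m) λ a → lookup M a ≡ just b) → ∀ a b → ¬ BlockingEdge J M a b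
  favourites-unblocked M favourites covers a b (_ , b-prefers-a)
    with a' , Ma'≡b ← covers b = favourite-unbeaten (favourites a' b Ma'≡b) (b-prefers-a a' Ma'≡b)

module LegalCriterion {m} (J : Instance m) (X Y : RawMatching m → Set)
  (X? : ∀ N → Dec (X N)) (Y? : ∀ N → Dec (Y N))
  (X⊆matchings : ∀ N → X N → IsMatching N) (X⊆Y : ∀ N → X N → Y N)
  (W : RawMatching m) (W∈X : X W) (W-unblocked : ∀ a b → ¬ BlockingEdge J W a b)
  (Y-cannot-block-X : ∀ N N' → X N → IsMatching N' → Y N' → ¬ Blocks J N' N)
  (W-blocks-outside-Y : ∀ N → IsMatching N → ¬ Y N → Blocks J W N)
  (X-blocks-Y∖X : ∀ N → IsMatching N → Y N → ¬ X N → Σ (RawMatching m) λ N' → X N' × Blocks J N' N)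
  where

  X-blocks-outside-X : ∀ N → IsMatching N → ¬ X N → Σ (RawMatching m) λ N' → X N' × Blocks J N' N
  X-blocks-outside-X N N-matching ¬xN with Y? N
  ... | yes yN = X-blocks-Y∖X N N-matching yN ¬xN
  ... | no ¬yN = W , W∈X , W-blocks-outside-Y N N-matching ¬yN

  legalSet : MatchingSet m
  legalSet N = does (X? N)

  legalSet≐X : legalSet ≐ X
  legalSet≐X N = does≡true⇔ (X? N)

  legalSet-legal : Legal J legalSet
  legalSet-legal = (λ N → X⊆matchings N ∘ to (legalSet≐X N)) , λ N N-matching → mk⇔
    (λ { (N' , N'∈ , blocks) N∈ → let xN' = to (legalSet≐X N') N'∈ in
         Y-cannot-block-X N N' (to (legalSet≐X N) N∈) (X⊆matchings N' xN') (X⊆Y N' xN') blocks })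
    (λ N∉ → let N' , xN' , blocks = X-blocks-outside-X N N-matching (N∉ ∘ from (legalSet≐X N)) in
       N' , from (legalSet≐X N') xN' , blocks)

  legal-unique : ∀ 𝓛 → Legal J 𝓛 → 𝓛 ≐ X
  legal-unique 𝓛 (𝓛⊆matchings , blocked⇔∉) N = mk⇔ (𝓛⊆X N) (X⊆𝓛 N)
    where
    unblocked⇒∈ : ∀ N → IsMatching N →
      ¬ (Σ (RawMatching m) λ N' → 𝓛 N' ≡ true × Blocks J N' N) → 𝓛 N ≡ true
    unblocked⇒∈ N N-matching unblocked =
      decidable-stable (𝓛 N ≟ᵇ true) (unblocked ∘ from (blocked⇔∉ N N-matching))

    ∈-unblocked : ∀ {N N'} → 𝓛 N ≡ true → 𝓛 N' ≡ true → ¬ Blocks J N' N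
    ∈-unblocked {N} {N'} N∈ N'∈ blocks = to (blocked⇔∉ N (𝓛⊆matchings N N∈)) (N' , N'∈ , blocks) N∈

    W∈𝓛 : 𝓛 W ≡ true
    W∈𝓛 = unblocked⇒∈ W (X⊆matchings W W∈X) λ (_ , _ , a , b , _ , blocks) → W-unblocked a b blocks

    𝓛⊆Y : ∀ N → 𝓛 N ≡ true → Y N
    𝓛⊆Y N N∈ = decidable-stable (Y? N) λ ¬yN →
      ∈-unblocked N∈ W∈𝓛 (W-blocks-outside-Y N (𝓛⊆matchings N N∈) ¬yN)

    X⊆𝓛 : ∀ N → X N → 𝓛 N ≡ true
    X⊆𝓛 N xN = unblocked⇒∈ N (X⊆matchings N xN) λ (N' , N'∈ , blocks) →
      Y-cannot-block-X N N' xN (𝓛⊆matchings N' N'∈) (𝓛⊆Y N' N'∈) blocks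

    𝓛⊆X : ∀ N → 𝓛 N ≡ true → X N
    𝓛⊆X N N∈ = decidable-stable (X? N) λ ¬xN →
      let N' , xN' , blocks = X-blocks-outside-X N (𝓛⊆matchings N N∈) ¬xN in
      ∈-unblocked N∈ (X⊆𝓛 N' xN') blocks

module Latin {n} (I : Instance n) (Q : Fin n → Fin n → Fin n)
  (rows : ∀ a → Injective _≡_ _≡_ (Q a)) (columns : ∀ b → Injective _≡_ _≡_ (λ a → Q a b))
  (rankA≡Q : ∀ a b → rankA I a b ≡ Q a b) (rankB≡Q : ∀ a b → rankB I b a ≡ opposite (Q a b)) where

  rowInverse : Fin n → Fin n → Fin n
  rowInverse a k = proj₁ (injective⇒strictlySurjective (rows a) k)

  Q-rowInverse : ∀ a k → Q a (rowInverse a k) ≡ k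
  Q-rowInverse a k = proj₂ (injective⇒strictlySurjective (rows a) k)

  columnInverse : Fin n → Fin n → Fin n
  columnInverse b k = proj₁ (injective⇒strictlySurjective (columns b) k)

  Q-columnInverse : ∀ b k → Q (columnInverse b k) b ≡ k
  Q-columnInverse b k = proj₂ (injective⇒strictlySurjective (columns b) k)

  rankMatching : Fin n → RawMatching n
  rankMatching k = tabulate λ a → just (rowInverse a k)

  rankMatching-pairs : ∀ k {a b} → lookup (rankMatching k) a ≡ just b ⇔ Q a b ≡ k
  rankMatching-pairs k {a} = mk⇔
    (λ Ma≡b → subst (λ b → Q a b ≡ k) (just-injective (trans (sym (lookup∘tabulate _ a)) Ma≡b))
                    (Q-rowInverse a k))
    (λ Qab≡k → trans (lookup∘tabulate _ a) (cong just (rows a (trans (Q-rowInverse a k) (sym Qab≡k)))))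

  -- A blocking edge ab would need Q a b < k for a, and, as b's ranks are reversed, Q a b > k for b.
  rankMatching-stable : ∀ k → Stable I (rankMatching k)
  rankMatching-stable k = isMatching , unblocked
    where
    isMatching : IsMatching (rankMatching k)
    isMatching a a' b Ma≡b Ma'≡b =
      columns b (trans (to (rankMatching-pairs k) Ma≡b) (sym (to (rankMatching-pairs k) Ma'≡b)))

    unblocked : ∀ a b → ¬ BlockingEdge I (rankMatching k) a b
    unblocked a b (a-prefers-b , b-prefers-a) = <-asym Qab<k k<Qab
      where
      Qab<k : toℕ (Q a b) < toℕ k
      Qab<k = subst₂ (λ x y → toℕ x < toℕ y) (rankA≡Q a b) (trans (rankA≡Q a _) (Q-rowInverse a k))
        (to (prefersA-matched I (rankMatching k) (lookup∘tabulate _ a)) a-prefers-b)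

      k<Qab : toℕ k < toℕ (Q a b)
      k<Qab = opposite-reflects-<
        (subst₂ (λ x y → toℕ x < toℕ y) (rankB≡Q a b)
          (trans (rankB≡Q _ b) (cong opposite (Q-columnInverse b k)))
          (b-prefers-a (columnInverse b k) (from (rankMatching-pairs k) (Q-columnInverse b k))))

  latin-cover : ∀ a b → Σ (RawMatching n) λ M → Stable I M × lookup M a ≡ just b
  latin-cover a b = rankMatching (Q a b) , rankMatching-stable (Q a b) , from (rankMatching-pairs (Q a b)) refl

  -- a is the favourite of the woman he ranks last.
  latin-favourite : ∀ a → Σ (Fin n) λ b → Favourite I b a
  latin-favourite a = b , (begin
    toℕ (rankB I b a)                ≡⟨ cong toℕ (rankB≡Q a b) ⟩
    toℕ (opposite (Q a b))           ≡⟨ cong (toℕ ∘ opposite) (Q-rowInverse a (opposite first)) ⟩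
    toℕ (opposite (opposite first))  ≡⟨ cong toℕ (opposite-involutive first) ⟩
    toℕ first                        ≡⟨ toℕ-fromℕ< _ ⟩
    0                                ∎)
    where
    open ≡-Reasoning
    first : Fin n
    first = fromℕ< (≤-<-trans z≤n (toℕ<n a))
    b : Fin n
    b = rowInverse a (opposite first)

module Auxiliary {n} (I : Instance n) (I' : Instance (suc n))
  (b̃-last : ∀ a → rankA I' (fs a) fz ≡ fromℕ n)
  (≻A-inherited : ∀ a b b' → (I' ∶ fs a ≻A fs b , fs b') ⇔ (I ∶ a ≻A b , b'))
  (ã-second : ∀ b → toℕ (rankB I' (fs b) fz) ≡ 1)
  (≻B-inherited : ∀ b a a' → (I' ∶ fs b ≻B fs a , fs a') ⇔ (I ∶ b ≻B a , a'))
  (ã-favourite : Favourite I' fz fz)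
  (cover : ∀ a b → Σ (RawMatching n) λ M → Stable I M × lookup M a ≡ just b)
  (favourite-of : ∀ a → Σ (Fin n) λ b → Favourite I b a)
  where

  b̃-ranked-last : ∀ a b → I' ∶ fs a ≻A fs b , fz
  b̃-ranked-last a b = subst (λ r → toℕ (rankA I' (fs a) (fs b)) < toℕ r) (sym (b̃-last a))
    (≤∧≢⇒< (≤fromℕ _) λ e → 0≢1+n (sym (injA I' (fs a) (trans e (sym (b̃-last a))))))

  favourite-inherited : ∀ {b a} → Favourite I b a → Favourite I' (fs b) (fs a)
  favourite-inherited {b} {a} fav with x , rank≡0 ← injective⇒strictlySurjective (injB I' (fs b)) fz =
    subst (Favourite I' (fs b)) (favourite-is-fs x (cong toℕ rank≡0)) (cong toℕ rank≡0)
    where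
    favourite-is-fs : ∀ x → Favourite I' (fs b) x → x ≡ fs a
    favourite-is-fs fz fav' with () ← trans (sym (ã-second b)) fav'
    favourite-is-fs (fs a') fav' with a' ≟ a
    ... | yes refl = refl
    ... | no a'≢a = contradiction (from (≻B-inherited b a a') (favourite-preferred I fav a'≢a))
                                  (favourite-unbeaten I' fav')

  partner : Fin n → Fin n
  partner a = proj₁ (favourite-of a)

  partner-injective : Injective _≡_ _≡_ partner
  partner-injective {a} {a'} eq =
    favourite-unique I (proj₂ (favourite-of a))
      (subst (λ b → Favourite I b a') (sym eq) (proj₂ (favourite-of a')))

  W : RawMatching (suc n)
  W = just fz ∷ tabulate (λ a → just (fs (partner a)))

  W-favourites : ∀ x y → lookup W x ≡ just y → Favourite I' y x
  W-favourites fz y refl = ã-favourite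
  W-favourites (fs a) y Wa≡y with refl ← trans (sym (lookup∘tabulate _ a)) Wa≡y =
    favourite-inherited (proj₂ (favourite-of a))

  W-covers : ∀ y → Σ (Fin (suc n)) λ x → lookup W x ≡ just y
  W-covers fz = fz , refl
  W-covers (fs b) with a , partner-a≡b ← injective⇒strictlySurjective partner-injective b =
    fs a , trans (lookup∘tabulate _ a) (cong (just ∘ fs) partner-a≡b)

  W-unblocked : ∀ x y → ¬ BlockingEdge I' W x y
  W-unblocked = favourites-unblocked I' W W-favourites W-covers

  Pairsãb̃ : RawMatching (suc n) → Set
  Pairsãb̃ N = lookup N fz ≡ just fz

  StableOnG : RawMatching (suc n) → Set
  StableOnG N = IsMatching N × Pairsãb̃ N × (∀ a b → ¬ BlockingEdge I' N (fs a) (fs b))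

  stableOnG? : ∀ N → Dec (StableOnG N)
  stableOnG? N = isMatching? I' N ×-dec (lookup N fz ≟ₘ just fz) ×-dec
    all? λ a → all? λ b → ¬? (blockingEdge? I' N (fs a) (fs b))

  W-stableOnG : StableOnG W
  W-stableOnG = favourites-isMatching I' W W-favourites , refl , λ a b → W-unblocked (fs a) (fs b)

  pairsãb̃-cannot-block : ∀ N N' → StableOnG N → IsMatching N' → Pairsãb̃ N' → ¬ Blocks I' N' N
  pairsãb̃-cannot-block N _ (_ , Nã≡b̃ , _) _ N'ã≡b̃ (fz , y , N'ã≡y , ã-prefers , _)
    with refl ← trans (sym N'ã≡b̃) N'ã≡y = <-irrefl refl (to (prefersA-matched I' N Nã≡b̃) ã-prefers)
  pairsãb̃-cannot-block _ _ _ N'-matching N'ã≡b̃ (fs a , fz , N'a≡b̃ , _)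
    with () ← N'-matching _ _ _ N'a≡b̃ N'ã≡b̃
  pairsãb̃-cannot-block _ _ (_ , _ , unblocked) _ _ (fs a , fs b , _ , blocks) = unblocked a b blocks

  MatchedInB : RawMatching (suc n) → Fin n → Set
  MatchedInB N a = Σ (Fin n) λ b → lookup N (fs a) ≡ just (fs b)

  matchedInB-onto : ∀ {N} → IsMatching N → (∀ a → MatchedInB N a) →
    ∀ b → Σ (Fin n) λ a → lookup N (fs a) ≡ just (fs b)
  matchedInB-onto {N} N-matching all-matched b =
    let a , g-a≡b = injective⇒strictlySurjective g-injective b in
    a , subst (λ b → lookup N (fs a) ≡ just (fs b)) g-a≡b (proj₂ (all-matched a))
    where
    g : Fin n → Fin n
    g a = proj₁ (all-matched a)
    g-injective : Injective _≡_ _≡_ g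
    g-injective {a} {a'} eq = suc-injective (N-matching (fs a) (fs a') (fs (g a)) (proj₂ (all-matched a))
      (subst (λ b → lookup N (fs a') ≡ just (fs b)) (sym eq) (proj₂ (all-matched a'))))

  someone-unmatched-in-B : ∀ {N b} → IsMatching N → lookup N fz ≡ just (fs b) →
    Σ (Fin n) λ a → ¬ MatchedInB N a
  someone-unmatched-in-B {N} {b} N-matching Nã≡b
    with all? (λ a → any? λ b → lookup N (fs a) ≟ₘ just (fs b))
  ... | no ¬all = ¬∀⟶∃¬ n _ (λ a → any? λ b → lookup N (fs a) ≟ₘ just (fs b)) ¬all
  ... | yes all-matched with a , Na≡b ← matchedInB-onto {N} N-matching all-matched b
    with () ← N-matching (fs a) fz (fs b) Na≡b Nã≡b

  prefers-if-unmatched-in-B : ∀ N {a} b → ¬ MatchedInB N a → PrefersToPartnerA I' N (fs a) (fs b)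
  prefers-if-unmatched-in-B N {a} b unmatched with lookup N (fs a)
  ... | nothing = tt
  ... | just fz = b̃-ranked-last a b
  ... | just (fs b') = ⊥-elim (unmatched (b' , refl))

  W-blocks-without-ãb̃ : ∀ N → IsMatching N → ¬ Pairsãb̃ N → Blocks I' W N
  W-blocks-without-ãb̃ N N-matching ¬pairs with lookup N fz in Nã≡
  ... | nothing = fz , fz , refl , prefersA-unmatched I' N Nã≡ ,
      λ a' Na'≡b̃ → favourite-preferred I' ã-favourite (a'≢ã Na'≡b̃)
    where
    a'≢ã : ∀ {a'} → lookup N a' ≡ just fz → a' ≢ fz
    a'≢ã Na'≡b̃ refl with () ← trans (sym Nã≡) Na'≡b̃
  ... | just fz = ⊥-elim (¬pairs refl)
  ... | just (fs b) with a , unmatched ← someone-unmatched-in-B {N} N-matching Nã≡ =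
    fs a , fs (partner a) , lookup∘tabulate _ a , prefers-if-unmatched-in-B N _ unmatched ,
    λ x Nx≡ → favourite-preferred I' (favourite-inherited (proj₂ (favourite-of a))) (x≢a Nx≡)
    where
    x≢a : ∀ {x} → lookup N x ≡ just (fs (partner a)) → x ≢ fs a
    x≢a Nx≡ refl = unmatched (partner a , Nx≡)

  extend-lookup : ∀ (M : RawMatching n) a → lookup (extend M) (fs a) ≡ mmap fs (lookup M a)
  extend-lookup M a = lookup-map a (mmap fs) M

  extend-pairs : ∀ (M : RawMatching n) {a b} → lookup M a ≡ just b → lookup (extend M) (fs a) ≡ just (fs b)
  extend-pairs M {a} Ma≡b = trans (extend-lookup M a) (cong (mmap fs) Ma≡b)

  extend-pairs⁻¹ : ∀ (M : RawMatching n) x {b} → lookup (extend M) x ≡ just (fs b) →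
    Σ (Fin n) λ a → x ≡ fs a × lookup M a ≡ just b
  extend-pairs⁻¹ M (fs a) Mx≡b = a , refl , mmap-fs (trans (sym (extend-lookup M a)) Mx≡b)
    where
    mmap-fs : ∀ {y : Maybe (Fin n)} {b} → mmap fs y ≡ just (fs b) → y ≡ just b
    mmap-fs {just _} refl = refl

  extend-pairs-b̃ : ∀ (M : RawMatching n) x → lookup (extend M) x ≡ just fz → x ≡ fz
  extend-pairs-b̃ M fz _ = refl
  extend-pairs-b̃ M (fs a) Mx≡b̃ = ⊥-elim (mmap-fs≢b̃ (lookup M a) (trans (sym (extend-lookup M a)) Mx≡b̃))
    where
    mmap-fs≢b̃ : ∀ (y : Maybe (Fin n)) → mmap fs y ≢ just fz
    mmap-fs≢b̃ nothing ()
    mmap-fs≢b̃ (just _) ()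

  extend-isMatching : ∀ (M : RawMatching n) → IsMatching M → IsMatching (extend M)
  extend-isMatching M _ x x' fz Mx≡b̃ Mx'≡b̃ =
    trans (extend-pairs-b̃ M x Mx≡b̃) (sym (extend-pairs-b̃ M x' Mx'≡b̃))
  extend-isMatching M M-matching x x' (fs b) Mx≡b Mx'≡b
    with a , refl , Ma≡b ← extend-pairs⁻¹ M x Mx≡b | a' , refl , Ma'≡b ← extend-pairs⁻¹ M x' Mx'≡b =
    cong fs (M-matching a a' b Ma≡b Ma'≡b)

  isMatching-unextend : ∀ (M : RawMatching n) → IsMatching (extend M) → IsMatching M
  isMatching-unextend M matching a a' b Ma≡b Ma'≡b =
    suc-injective (matching (fs a) (fs a') (fs b) (extend-pairs M Ma≡b) (extend-pairs M Ma'≡b))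

  extend-prefersA : ∀ (M : RawMatching n) a b →
    PrefersToPartnerA I' (extend M) (fs a) (fs b) ⇔ PrefersToPartnerA I M a b
  extend-prefersA M a b with lookup M a in Ma≡
  ... | nothing =
    mk⇔ (const tt) (const (prefersA-unmatched I' (extend M) (trans (extend-lookup M a) (cong (mmap fs) Ma≡))))
  ... | just b' = ⇔.trans (prefersA-matched I' (extend M) (extend-pairs M Ma≡)) (≻A-inherited a b b')

  extend-prefersB : ∀ (M : RawMatching n) b a →
    PrefersToPartnerB I' (extend M) (fs b) (fs a) ⇔ PrefersToPartnerB I M b a
  extend-prefersB M b a = mk⇔
    (λ b-prefers a' Ma'≡b → to (≻B-inherited b a a') (b-prefers (fs a') (extend-pairs M Ma'≡b)))
    lift
    where
    lift : PrefersToPartnerB I M b a → PrefersToPartnerB I' (extend M) (fs b) (fs a)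
    lift b-prefers x Mx≡b with a' , refl , Ma'≡b ← extend-pairs⁻¹ M x Mx≡b =
      from (≻B-inherited b a a') (b-prefers a' Ma'≡b)

  extend-blockingEdge : ∀ (M : RawMatching n) a b →
    BlockingEdge I' (extend M) (fs a) (fs b) ⇔ BlockingEdge I M a b
  extend-blockingEdge M a b = extend-prefersA M a b ×-⇔ extend-prefersB M b a

  extend-stableOnG : ∀ {M} → Stable I M → StableOnG (extend M)
  extend-stableOnG {M} (M-matching , unblocked) =
    extend-isMatching M M-matching , refl , λ a b → unblocked a b ∘ to (extend-blockingEdge M a b)

  unshift : Maybe (Fin (suc n)) → Maybe (Fin n)
  unshift (just (fs b)) = just b
  unshift _ = nothing

  shift-unshift : ∀ {k} (xs : Vec (Maybe (Fin (suc n))) k) → (∀ i → lookup xs i ≢ just fz) →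
    map (mmap fs) (map unshift xs) ≡ xs
  shift-unshift [] _ = refl
  shift-unshift (nothing ∷ xs) avoids-b̃ = cong (nothing ∷_) (shift-unshift xs (avoids-b̃ ∘ fs))
  shift-unshift (just fz ∷ xs) avoids-b̃ = ⊥-elim (avoids-b̃ fz refl)
  shift-unshift (just (fs b) ∷ xs) avoids-b̃ = cong (just (fs b) ∷_) (shift-unshift xs (avoids-b̃ ∘ fs))

  stableOnG⇒extendedStable : ∀ {N} → StableOnG N → ExtendedStable I N
  stableOnG⇒extendedStable {x ∷ xs} stable@(N-matching , x≡b̃ , _) =
    M , M-stable , N≡extend-M
    where
    M : RawMatching n
    M = map unshift xs
    N≡extend-M : x ∷ xs ≡ extend M
    N≡extend-M = cong₂ _∷_ x≡b̃ (sym (shift-unshift xs λ i xsᵢ≡b̃ →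
      0≢1+n (sym (N-matching (fs i) fz fz xsᵢ≡b̃ x≡b̃))))
    M-stable : Stable I M
    M-stable with matching , _ , unblocked ← subst StableOnG N≡extend-M stable =
      isMatching-unextend M matching , λ a b → unblocked a b ∘ from (extend-blockingEdge M a b)

  extendedStable⇔stableOnG : ∀ N → ExtendedStable I N ⇔ StableOnG N
  extendedStable⇔stableOnG N =
    mk⇔ (λ { (M , M-stable , refl) → extend-stableOnG M-stable }) stableOnG⇒extendedStable

  cover-blocks : ∀ N → IsMatching N → Pairsãb̃ N → ¬ StableOnG N →
    Σ (RawMatching (suc n)) λ N' → StableOnG N' × Blocks I' N' N
  cover-blocks N N-matching pairs ¬stable
    with a , b , blocks ← ¬∀¬⇒∃₂ (λ a b → blockingEdge? I' N (fs a) (fs b))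
                                 (λ unblocked → ¬stable (N-matching , pairs , unblocked))
    with M , M-stable , Ma≡b ← cover a b =
    extend M , extend-stableOnG M-stable , fs a , fs b , extend-pairs M Ma≡b , blocks

  ≐stableOnG⇒≐extendedStable : ∀ {𝓛} → 𝓛 ≐ StableOnG → 𝓛 ≐ ExtendedStable I
  ≐stableOnG⇒≐extendedStable 𝓛≐ N = ⇔.trans (𝓛≐ N) (⇔.sym (extendedStable⇔stableOnG N))

lemma13 : ∀ (n : ℕ) (I : Instance n) (I' : Instance (suc n)) →
    IsLatinInstance I → IsAuxiliary I I' →
    (Σ (MatchingSet (suc n)) λ 𝓛 → Legal I' 𝓛 × (𝓛 ≐ ExtendedStable I)) ×
    (∀ 𝓛 → Legal I' 𝓛 → 𝓛 ≐ ExtendedStable I)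
lemma13 n I I' (Q , (rows , columns) , rankA≡Q , rankB≡Q)
               (b̃-last , ≻A-inherited , _ , ã-second , ≻B-inherited , ã-favourite) =
  (legalSet , legalSet-legal , ≐stableOnG⇒≐extendedStable legalSet≐X) ,
  λ 𝓛 𝓛-legal → ≐stableOnG⇒≐extendedStable (legal-unique 𝓛 𝓛-legal)
  where
  open Latin I Q rows columns rankA≡Q rankB≡Q
  open Auxiliary I I' b̃-last ≻A-inherited ã-second ≻B-inherited ã-favourite latin-cover latin-favourite
  open LegalCriterion I' StableOnG Pairsãb̃ stableOnG? (λ N → lookup N fz ≟ₘ just fz)
    (λ _ → proj₁) (λ _ → proj₁ ∘ proj₂)
    W W-stableOnG W-unblocked pairsãb̃-cannot-block W-blocks-without-ãb̃ cover-blocks
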